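{- Let $1\le m\le n$. Define numbers $c^{\ell}_{A,k}$ for $1\le \ell\le n$, $A\subseteq[n]$ and $1\le k\le n+1$ by $c^1_{A,k}=1$ for all $(A,k)$ and, for $1<\ell\le n$, \[c^{\ell}_{A,k}=\sum_{B\subseteq A}\ \sum_{i=p(A,B,k)}^{q(A,B,k)} c^{\ell-1}_{B,i},\] where \[p(A,B,k)=\max\big(\{j\in[n+1]: j<k,\ j\notin A,\ j-1\in B\}\cup\{1\}\big),\quad q(A,B,k)=\min\big(\{j\in[n+1]: j>k,\ j\in B,\ j-1\notin A\}\cup\{n+1\}\big).\] Then the number $K(n,m)$ of maximum arrangements of nonattacking kings on a $2m\times 2n$ rectangle (i.e. placements of $mn$ pairwise nonattacking kings on a board with $2m$ rows and $2n$ columns) equals \[K(n,m)=\sum_{A\subseteq[n]}\ \sum_{k=1}^{n+1} c^{m}_{A,k}.\]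
   Context: Two kings attack each other if their cells are distinct and adjacent horizontally, vertically or diagonally. The maximum number of pairwise nonattacking kings on a $2m\times 2n$ board is $mn$; arrangements are counted as fixed placements. Here $[n]=\{1,\dots,n\}$ and $[n+1]=\{1,\dots,n+1\}$. (In the paper the numbers $c^{\ell}_{A,k}$ are denoted $m^{\ell}_{A,k}$; they are renamed here to avoid a clash with the number of rows parameter $m$.) -}

module Defs where

open import Data.Bool using (Bool; true; false; _∧_; _∨_; not; if_then_else_)
open import Data.Nat using (ℕ; zero; suc; _+_; _*_; _∸_; _⊔_; _⊓_; _<ᵇ_; _≤ᵇ_; ∣_-_∣)
open import Data.Nat.Base using (_≡ᵇ_)
open import Data.Fin using (Fin; toℕ)
open import Data.Vec using (Vec; []; _∷_; lookup)
open import Data.List using (List; []; _∷_; map; _++_; concatMap; length; filterᵇ; upTo; allFin; foldr)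
open import Data.Bool.ListAction using (and)
open import Data.Nat.ListAction using (sum)

allVecs : {A : Set} → (k : ℕ) → List A → List (Vec A k)
allVecs zero    xs = [] ∷ []
allVecs (suc k) xs = concatMap (λ x → map (x ∷_) (allVecs k xs)) xs

bools : List Bool
bools = true ∷ false ∷ []

-- the integers p, p+1, ..., q (empty if q < p)
fromTo : ℕ → ℕ → List ℕ
fromTo p q = map (p +_) (upTo (suc q ∸ p))

Board : ℕ → ℕ → Set
Board r s = Vec (Vec Bool s) r

occ : {r s : ℕ} → Board r s → Fin r → Fin s → Bool
occ b i j = lookup (lookup b i) j

boolToℕ : Bool → ℕ
boolToℕ true  = 1
boolToℕ false = 0

kingCount : {r s : ℕ} → Board r s → ℕ
kingCount {r} {s} b =
  sum (map (λ i → sum (map (λ j → boolToℕ (occ b i j)) (allFin s))) (allFin r))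

attacks : {r s : ℕ} → Fin r → Fin s → Fin r → Fin s → Bool
attacks i j i' j' =
  not ((toℕ i ≡ᵇ toℕ i') ∧ (toℕ j ≡ᵇ toℕ j'))
  ∧ (∣ toℕ i - toℕ i' ∣ ≤ᵇ 1) ∧ (∣ toℕ j - toℕ j' ∣ ≤ᵇ 1)

all : {A : Set} → (A → Bool) → List A → Bool
all p xs = and (map p xs)

nonattacking : {r s : ℕ} → Board r s → Bool
nonattacking {r} {s} b =
  all (λ i → all (λ j → all (λ i' → all (λ j' →
        not (occ b i j ∧ occ b i' j' ∧ attacks i j i' j'))
      (allFin s)) (allFin r)) (allFin s)) (allFin r)

isMaxArrangement : (n m : ℕ) → Board (2 * m) (2 * n) → Bool
isMaxArrangement n m b = nonattacking b ∧ (kingCount b ≡ᵇ m * n)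

K : ℕ → ℕ → ℕ
K n m = length (filterᵇ (isMaxArrangement n m)
                        (allVecs (2 * m) (allVecs (2 * n) bools)))

-- The numbers c^ℓ_{A,k}. Subsets of [n] are Vec Bool n
-- (entry at position j-1 is true iff j ∈ A).

Sub : ℕ → Set
Sub n = Vec Bool n

_∈ₛ_ : {n : ℕ} → ℕ → Sub n → Bool
zero          ∈ₛ A       = false
suc j         ∈ₛ []      = false
suc zero      ∈ₛ (x ∷ A) = x
suc (suc j)   ∈ₛ (x ∷ A) = suc j ∈ₛ A

allSubs : (n : ℕ) → List (Sub n)
allSubs n = allVecs n bools

subsOf : {n : ℕ} → Sub n → List (Sub n)
subsOf []          = [] ∷ []
subsOf (true ∷ A)  = map (false ∷_) (subsOf A) ++ map (true ∷_) (subsOf A)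
subsOf (false ∷ A) = map (false ∷_) (subsOf A)

range1 : ℕ → List ℕ
range1 n = fromTo 1 (suc n)

pp : (n : ℕ) → Sub n → Sub n → ℕ → ℕ
pp n A B k = foldr _⊔_ 1
  (map (λ j → if (j <ᵇ k) ∧ not (j ∈ₛ A) ∧ ((j ∸ 1) ∈ₛ B) then j else 1) (range1 n))

qq : (n : ℕ) → Sub n → Sub n → ℕ → ℕ
qq n A B k = foldr _⊓_ (suc n)
  (map (λ j → if (k <ᵇ j) ∧ (j ∈ₛ B) ∧ not ((j ∸ 1) ∈ₛ A) then j else suc n) (range1 n))

-- c n ℓ A k = c^ℓ_{A,k}  (level 0 is unused and set to 0)
c : (n : ℕ) → ℕ → Sub n → ℕ → ℕ
c n zero          A k = 0
c n (suc zero)    A k = 1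
c n (suc (suc l)) A k =
  sum (map (λ B → sum (map (λ i → c n (suc l) B i) (fromTo (pp n A B k) (qq n A B k))))
           (subsOf A))

-- Cut the board into 2×2 blocks. Two kings in one block attack each other, so a maximum
-- arrangement has exactly one king in every block. In a horizontal strip of blocks, a king in
-- the right column of a block forces the kings of all later blocks into their right columns;
-- hence a strip is determined by the set A of blocks whose king is in the top row and the first
-- block k whose king is in the right column (k = n + 1 if there is none). A strip (B, i) fits
-- below (A, k) iff B ⊆ A (no attack within one column of blocks) and p(A,B,k) ≤ i ≤ q(A,B,k)
-- (no diagonal attack between neighbouring columns of blocks). So c^ℓ_{A,k} counts the arrangements on ℓ
-- strips whose top strip is (A, k), and summing over (A, k) gives K(n, m).

module Submission where

open import Data.Bool using (Bool; true; false; _∧_; _∨_; not; _xor_; if_then_else_; T)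
open import Data.Bool.Properties using (∧-zeroʳ; ∨-inverseʳ)
open import Data.Empty using (⊥; ⊥-elim)
open import Data.Fin using (Fin; zero; suc; toℕ)
open import Data.List using (List; []; _∷_; map; _++_; concatMap; length; filterᵇ; upTo; applyUpTo; allFin; foldr)
open import Data.List.Membership.Propositional using (_∈_)
open import Data.List.Membership.Propositional.Properties using (∈-allFin; ∈-map⁺; ∈-upTo⁺)
open import Data.List.Properties using (map-tabulate)
open import Data.List.Relation.Unary.All as All using ()
open import Data.List.Relation.Unary.All.Properties using (all⁺; all⁻)
open import Data.List.Relation.Unary.Any using (here; there)
open import Data.Nat using (ℕ; zero; suc; _+_; _*_; _∸_; _≤_; _<_; z≤n; s≤s; _≤ᵇ_; _<ᵇ_; _≡ᵇ_; _⊔_; _⊓_; ∣_-_∣)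
open import Data.Nat.ListAction using (sum)
open import Data.Nat.Properties
open import Algebra.Properties.CommutativeSemigroup +-commutativeSemigroup using () renaming (interchange to +-interchange)
open import Data.Nat.Solver using (module +-*-Solver)
open import Data.Nat.Tactic.RingSolver using (solve-∀)
open import Data.Product using (_×_; _,_; proj₁; proj₂)
open import Data.Unit using (tt)
open import Data.Vec using (Vec; []; _∷_; lookup)
open import Function using (_∘_)
open import Relation.Binary.PropositionalEquality

open import Defs

∧-intro : ∀ {a b} → T a → T b → T (a ∧ b)
∧-intro {true} {true} _ _ = tt

∧-fst : ∀ a {b} → T (a ∧ b) → T a
∧-fst true _ = tt

∧-snd : ∀ a {b} → T (a ∧ b) → T b
∧-snd true t = t

not-intro : ∀ {a} → (T a → ⊥) → T (not a)
not-intro {true} f = f tt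
not-intro {false} _ = tt

not-elim : ∀ {a} → T (not a) → T a → ⊥
not-elim {true} ()

T-injective : ∀ {a b} → (T a → T b) → (T b → T a) → a ≡ b
T-injective {true}  {true}  _ _ = refl
T-injective {true}  {false} f _ = ⊥-elim (f tt)
T-injective {false} {true}  _ g = ⊥-elim (g tt)
T-injective {false} {false} _ _ = refl

everyAssignment : (k : ℕ) → (Vec Bool k → Bool) → Bool
everyAssignment zero    f = f []
everyAssignment (suc k) f = everyAssignment k (f ∘ (true ∷_)) ∧ everyAssignment k (f ∘ (false ∷_))

everyAssignment-sound : ∀ k f → T (everyAssignment k f) → ∀ v → T (f v)
everyAssignment-sound zero    f t [] = t
everyAssignment-sound (suc k) f t (true ∷ v)  = everyAssignment-sound k _ (∧-fst (everyAssignment k _) t) v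
everyAssignment-sound (suc k) f t (false ∷ v) = everyAssignment-sound k _ (∧-snd (everyAssignment k _) t) v

xor-false⇒≡ : ∀ a b → T (not (a xor b)) → a ≡ b
xor-false⇒≡ true  true  _ = refl
xor-false⇒≡ false false _ = refl

bool-identity : ∀ k (f g : Vec Bool k → Bool) →
  T (everyAssignment k (λ v → not (f v xor g v))) → ∀ v → f v ≡ g v
bool-identity k f g t v = xor-false⇒≡ (f v) (g v) (everyAssignment-sound k _ t v)


∑ : {A : Set} → List A → (A → ℕ) → ℕ
∑ xs f = sum (map f xs)

syntax ∑ xs (λ x → e) = ∑[ x ← xs ] e

∑-++ : {A : Set} (xs ys : List A) (f : A → ℕ) → ∑ (xs ++ ys) f ≡ ∑ xs f + ∑ ys f
∑-++ []       ys f = refl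
∑-++ (x ∷ xs) ys f = trans (cong (f x +_) (∑-++ xs ys f)) (sym (+-assoc (f x) _ _))

∑-map : {A B : Set} (xs : List A) (g : A → B) (f : B → ℕ) → ∑ (map g xs) f ≡ ∑ xs (f ∘ g)
∑-map []       g f = refl
∑-map (x ∷ xs) g f = cong (f (g x) +_) (∑-map xs g f)

∑-concatMap : {A B : Set} (xs : List A) (g : A → List B) (f : B → ℕ) →
  ∑ (concatMap g xs) f ≡ ∑[ x ← xs ] ∑ (g x) f
∑-concatMap []       g f = refl
∑-concatMap (x ∷ xs) g f = trans (∑-++ (g x) _ f) (cong (∑ (g x) f +_) (∑-concatMap xs g f))

∑-cong : {A : Set} (xs : List A) {f g : A → ℕ} → (∀ x → f x ≡ g x) → ∑ xs f ≡ ∑ xs g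
∑-cong []       e = refl
∑-cong (x ∷ xs) e = cong₂ _+_ (e x) (∑-cong xs e)

∑-zero : {A : Set} (xs : List A) → ∑[ _ ← xs ] 0 ≡ 0
∑-zero []       = refl
∑-zero (x ∷ xs) = ∑-zero xs

∑-+ : {A : Set} (xs : List A) (f g : A → ℕ) → ∑[ x ← xs ] (f x + g x) ≡ ∑ xs f + ∑ xs g
∑-+ []       f g = refl
∑-+ (x ∷ xs) f g = trans (cong (f x + g x +_) (∑-+ xs f g)) (+-interchange (f x) (g x) _ _)

∑-*ˡ : {A : Set} (xs : List A) (k : ℕ) (f : A → ℕ) → ∑[ x ← xs ] (k * f x) ≡ k * ∑ xs f
∑-*ˡ []       k f = sym (*-zeroʳ k)
∑-*ˡ (x ∷ xs) k f = trans (cong (k * f x +_) (∑-*ˡ xs k f)) (sym (*-distribˡ-+ k (f x) _))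

∑-comm : {A B : Set} (xs : List A) (ys : List B) (f : A → B → ℕ) →
  ∑[ x ← xs ] ∑[ y ← ys ] f x y ≡ ∑[ y ← ys ] ∑[ x ← xs ] f x y
∑-comm []       ys f = sym (∑-zero ys)
∑-comm (x ∷ xs) ys f =
  trans (cong (∑ ys (f x) +_) (∑-comm xs ys f)) (sym (∑-+ ys (f x) (λ y → ∑[ x′ ← xs ] f x′ y)))

∑-allVecs : {A : Set} (k : ℕ) (xs : List A) (f : Vec A (suc k) → ℕ) →
  ∑ (allVecs (suc k) xs) f ≡ ∑[ x ← xs ] ∑[ v ← allVecs k xs ] f (x ∷ v)
∑-allVecs k xs f =
  trans (∑-concatMap xs _ f) (∑-cong xs (λ x → ∑-map (allVecs k xs) (x ∷_) f))

∑-allVecs² : {A : Set} (k : ℕ) (xs : List A) (f : Vec A (suc (suc k)) → ℕ) →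
  ∑ (allVecs (suc (suc k)) xs) f ≡ ∑[ x ← xs ] ∑[ y ← xs ] ∑[ v ← allVecs k xs ] f (x ∷ y ∷ v)
∑-allVecs² k xs f = trans (∑-allVecs (suc k) xs f) (∑-cong xs (λ x → ∑-allVecs k xs (f ∘ (x ∷_))))

∑-allFin : {n : ℕ} (f : Fin (suc n) → ℕ) → ∑ (allFin (suc n)) f ≡ f zero + ∑ (allFin n) (f ∘ suc)
∑-allFin {n} f =
  cong (λ xs → f zero + sum xs) (trans (map-tabulate suc f) (sym (map-tabulate (λ i → i) (f ∘ suc))))

length-filterᵇ : {A : Set} (p : A → Bool) (xs : List A) →
  length (filterᵇ p xs) ≡ ∑[ x ← xs ] boolToℕ (p x)
length-filterᵇ p []       = refl
length-filterᵇ p (x ∷ xs) with p x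
... | true  = cong suc (length-filterᵇ p xs)
... | false = length-filterᵇ p xs

boolToℕ-∧ : ∀ a b → boolToℕ (a ∧ b) ≡ boolToℕ a * boolToℕ b
boolToℕ-∧ true  b = sym (+-identityʳ (boolToℕ b))
boolToℕ-∧ false b = refl

∑< : ℕ → (ℕ → ℕ) → ℕ
∑< zero    f = 0
∑< (suc m) f = f 0 + ∑< m (f ∘ suc)

syntax ∑< m (λ j → e) = ∑[ j < m ] e

∑<-cong : ∀ m {f g : ℕ → ℕ} → (∀ j → j < m → f j ≡ g j) → ∑< m f ≡ ∑< m g
∑<-cong zero    e = refl
∑<-cong (suc m) e = cong₂ _+_ (e 0 (s≤s z≤n)) (∑<-cong m (λ j j<m → e (suc j) (s≤s j<m)))

∑<-zero : ∀ m → ∑[ _ < m ] 0 ≡ 0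
∑<-zero zero    = refl
∑<-zero (suc m) = ∑<-zero m

∑<-*ˡ : ∀ m k f → ∑[ j < m ] (k * f j) ≡ k * ∑< m f
∑<-*ˡ zero    k f = sym (*-zeroʳ k)
∑<-*ˡ (suc m) k f = trans (cong (k * f 0 +_) (∑<-*ˡ m k (f ∘ suc))) (sym (*-distribˡ-+ k (f 0) _))

∑-applyUpTo : ∀ m (f : ℕ → ℕ) (G : ℕ → ℕ) → ∑ (applyUpTo f m) G ≡ ∑[ j < m ] G (f j)
∑-applyUpTo zero    f G = refl
∑-applyUpTo (suc m) f G = cong (G (f 0) +_) (∑-applyUpTo m (f ∘ suc) G)

∑-fromTo : ∀ p q (G : ℕ → ℕ) → ∑ (fromTo p q) G ≡ ∑[ j < suc q ∸ p ] G (p + j)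
∑-fromTo p q G = trans (∑-map (upTo (suc q ∸ p)) (p +_) G) (∑-applyUpTo (suc q ∸ p) (λ j → j) (G ∘ (p +_)))

≤ᵇ-suc : ∀ p j → (suc p ≤ᵇ suc j) ≡ (p ≤ᵇ j)
≤ᵇ-suc zero    j = refl
≤ᵇ-suc (suc p) j = refl

∑<-window : ∀ N p q (G : ℕ → ℕ) → q ≤ N →
  ∑[ j < N ] (boolToℕ ((p ≤ᵇ j) ∧ (j <ᵇ q)) * G j) ≡ ∑[ j < q ∸ p ] G (p + j)
∑<-window N p zero G _ = begin
  ∑[ j < N ] (boolToℕ ((p ≤ᵇ j) ∧ false) * G j) ≡⟨ ∑<-cong N (λ j _ → cong (λ b → boolToℕ b * G j) (∧-zeroʳ (p ≤ᵇ j))) ⟩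
  ∑[ j < N ] 0                                  ≡⟨ ∑<-zero N ⟩
  0                                             ≡⟨ cong (λ m → ∑[ j < m ] G (p + j)) (sym (0∸n≡0 p)) ⟩
  ∑[ j < 0 ∸ p ] G (p + j)                      ∎
  where open ≡-Reasoning
∑<-window (suc N) zero    (suc q) G (s≤s q≤N) =
  cong₂ _+_ (+-identityʳ (G 0)) (∑<-window N zero q (G ∘ suc) q≤N)
∑<-window (suc N) (suc p) (suc q) G (s≤s q≤N) =
  trans (∑<-cong N (λ j _ → cong (λ b → boolToℕ (b ∧ (j <ᵇ q)) * G (suc j)) (≤ᵇ-suc p j)))
        (∑<-window N p q (G ∘ suc) q≤N)

∑<-indicator-fromTo : ∀ n p q (G : ℕ → ℕ) → 1 ≤ p → q ≤ suc n →
  ∑[ j < suc n ] (boolToℕ ((p ≤ᵇ suc j) ∧ (suc j ≤ᵇ q)) * G (suc j)) ≡ ∑ (fromTo p q) G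
∑<-indicator-fromTo n (suc p) q G _ q≤ =
  trans (∑<-window (suc (suc n)) (suc p) (suc q) G (s≤s q≤)) (sym (∑-fromTo (suc p) q G))

-- The nonattacking condition, row by row

all-allFin⁻ : ∀ {n} (p : Fin n → Bool) → T (all p (allFin n)) → ∀ i → T (p i)
all-allFin⁻ p t i = All.lookup (all⁺ p _ t) (∈-allFin i)

all-allFin⁺ : ∀ {n} (p : Fin n → Bool) → (∀ i → T (p i)) → T (all p (allFin n))
all-allFin⁺ {n} p f = all⁻ p {allFin n} (All.tabulate (λ {i} _ → f i))

Row : ℕ → Set
Row s = Vec Bool s

firstCell : ∀ {s} → Row s → Bool
firstCell []      = false
firstCell (a ∷ _) = a

rowSafe : ∀ {s} → Row s → Bool
rowSafe []      = true
rowSafe (a ∷ x) = not (a ∧ firstCell x) ∧ rowSafe x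

rowsSafe : ∀ {s} → Row s → Row s → Bool
rowsSafe []      []      = true
rowsSafe (a ∷ x) (b ∷ y) = not (a ∧ b) ∧ not (a ∧ firstCell y) ∧ not (b ∧ firstCell x) ∧ rowsSafe x y

safeAbove : ∀ {r s} → Row s → Board r s → Bool
safeAbove x []      = true
safeAbove x (y ∷ _) = rowsSafe x y

boardSafe : ∀ {r s} → Board r s → Bool
boardSafe []      = true
boardSafe (x ∷ b) = rowSafe x ∧ safeAbove x b ∧ boardSafe b

Nonattacking : ∀ {r s} → Board r s → Set
Nonattacking b = ∀ i j i′ j′ → T (occ b i j) → T (occ b i′ j′) → T (attacks i j i′ j′) → ⊥

RowNonattacking : ∀ {s} → Row s → Set
RowNonattacking x = Nonattacking (x ∷ [])

AdjacentRowsNonattacking : ∀ {s} → Row s → Row s → Set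
AdjacentRowsNonattacking {s} x y =
  ∀ (j j′ : Fin s) → T (lookup x j) → T (lookup y j′) → T (∣ toℕ j - toℕ j′ ∣ ≤ᵇ 1) → ⊥

nonattacking⇔ : ∀ {r s} (b : Board r s) → (T (nonattacking b) → Nonattacking b) × (Nonattacking b → T (nonattacking b))
nonattacking⇔ b =
  (λ t i j i′ j′ o o′ a →
     not-elim (all-allFin⁻ _ (all-allFin⁻ _ (all-allFin⁻ _ (all-allFin⁻ _ t i) j) i′) j′) (∧-intro o (∧-intro o′ a))) ,
  (λ na → all-allFin⁺ _ λ i → all-allFin⁺ _ λ j → all-allFin⁺ _ λ i′ → all-allFin⁺ _ λ j′ → not-intro λ t →
     na i j i′ j′ (∧-fst (occ b i j) t) (∧-fst (occ b i′ j′) (∧-snd (occ b i j) t))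
                  (∧-snd (occ b i′ j′) (∧-snd (occ b i j) t)))

rowSafe⇒ : ∀ {s} (x : Row s) → T (rowSafe x) → RowNonattacking x
rowSafe⇒ (a ∷ x) t zero zero zero zero _ _ ()
rowSafe⇒ (a ∷ b ∷ x) t zero zero zero (suc zero) o o′ _ = not-elim (∧-fst (not (a ∧ b)) t) (∧-intro o o′)
rowSafe⇒ (a ∷ b ∷ x) t zero (suc zero) zero zero o o′ _ = not-elim (∧-fst (not (a ∧ b)) t) (∧-intro o′ o)
rowSafe⇒ (a ∷ b ∷ x) t zero zero zero (suc (suc j′)) _ _ ()
rowSafe⇒ (a ∷ b ∷ x) t zero (suc (suc j)) zero zero _ _ ()
rowSafe⇒ (a ∷ x) t zero (suc j) zero (suc j′) =
  rowSafe⇒ x (∧-snd (not (a ∧ firstCell x)) t) zero j zero j′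

rowSafe⇐ : ∀ {s} (x : Row s) → RowNonattacking x → T (rowSafe x)
rowSafe⇐ []          _  = tt
rowSafe⇐ (a ∷ [])    _  = ∧-intro (not-intro (∧-snd a)) tt
rowSafe⇐ (a ∷ b ∷ x) na =
  ∧-intro (not-intro λ t → na zero zero zero (suc zero) (∧-fst a t) (∧-snd a t) tt)
          (rowSafe⇐ (b ∷ x) λ { zero j zero j′ → na zero (suc j) zero (suc j′) })

rowsSafe⇒ : ∀ {s} (x y : Row s) → T (rowsSafe x y) → AdjacentRowsNonattacking x y
rowsSafe⇒ (a ∷ x) (b ∷ y) t zero zero o o′ _ =
  not-elim (∧-fst (not (a ∧ b)) t) (∧-intro o o′)
rowsSafe⇒ (a ∷ x) (b ∷ c ∷ y) t zero (suc zero) o o′ _ =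
  not-elim (∧-fst (not (a ∧ c)) (∧-snd (not (a ∧ b)) t)) (∧-intro o o′)
rowsSafe⇒ (a ∷ c ∷ x) (b ∷ y) t (suc zero) zero o o′ _ =
  not-elim (∧-fst (not (b ∧ c)) (∧-snd (not (a ∧ firstCell y)) (∧-snd (not (a ∧ b)) t))) (∧-intro o′ o)
rowsSafe⇒ (a ∷ x) (b ∷ c ∷ y) t zero (suc (suc j′)) _ _ ()
rowsSafe⇒ (a ∷ c ∷ x) (b ∷ y) t (suc (suc j)) zero _ _ ()
rowsSafe⇒ (a ∷ x) (b ∷ y) t (suc j) (suc j′) =
  rowsSafe⇒ x y (∧-snd (not (b ∧ firstCell x)) (∧-snd (not (a ∧ firstCell y)) (∧-snd (not (a ∧ b)) t))) j j′

rowsSafe⇐ : ∀ {s} (x y : Row s) → AdjacentRowsNonattacking x y → T (rowsSafe x y)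
rowsSafe⇐ []      []      _  = tt
rowsSafe⇐ (a ∷ x) (b ∷ y) na =
  ∧-intro (not-intro λ t → na zero zero (∧-fst a t) (∧-snd a t) tt)
  (∧-intro (not-intro (diagonal↘ x y na))
  (∧-intro (not-intro (diagonal↙ x y na))
           (rowsSafe⇐ x y λ j j′ → na (suc j) (suc j′))))
  where
  diagonal↘ : ∀ {s} (x y : Row s) → AdjacentRowsNonattacking (a ∷ x) (b ∷ y) → T (a ∧ firstCell y) → ⊥
  diagonal↘ x []      na t = ∧-snd a t
  diagonal↘ x (c ∷ y) na t = na zero (suc zero) (∧-fst a t) (∧-snd a t) tt
  diagonal↙ : ∀ {s} (x y : Row s) → AdjacentRowsNonattacking (a ∷ x) (b ∷ y) → T (b ∧ firstCell x) → ⊥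
  diagonal↙ []      y na t = ∧-snd b t
  diagonal↙ (c ∷ x) y na t = na (suc zero) zero (∧-snd b t) (∧-fst b t) tt

nonattacking-head : ∀ {r s} {x : Row s} {b : Board r s} → Nonattacking (x ∷ b) → RowNonattacking x
nonattacking-head na zero j zero j′ = na zero j zero j′

nonattacking-tail : ∀ {r s} {x : Row s} {b : Board r s} → Nonattacking (x ∷ b) → Nonattacking b
nonattacking-tail na i j i′ j′ = na (suc i) j (suc i′) j′

nonattacking-adjacent : ∀ {r s} {x y : Row s} {b : Board r s} → Nonattacking (x ∷ y ∷ b) → AdjacentRowsNonattacking x y
nonattacking-adjacent na j j′ o o′ = na zero j (suc zero) j′ o o′

nonattacking-∷ : ∀ {r s} (x : Row s) (b : Board r s) →
  RowNonattacking x → T (safeAbove x b) → Nonattacking b → Nonattacking (x ∷ b)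
nonattacking-∷ x b       nx _ _  zero    j zero    j′ = nx zero j zero j′
nonattacking-∷ x b       _  _ nb (suc i) j (suc i′) j′ = nb i j i′ j′
nonattacking-∷ x (y ∷ b) _  t _  zero    j (suc zero) j′ o o′ a = rowsSafe⇒ x y t j j′ o o′ a
nonattacking-∷ x (y ∷ b) _  t _  (suc zero) j zero j′ o o′ a =
  rowsSafe⇒ x y t j′ j o′ o (subst (λ d → T (d ≤ᵇ 1)) (∣-∣-comm (toℕ j) (toℕ j′)) a)
nonattacking-∷ x (y ∷ b) _  _ _  zero    j (suc (suc i′)) j′ _ _ ()
nonattacking-∷ x (y ∷ b) _  _ _  (suc (suc i)) j zero j′ _ _ ()

boardSafe⇒ : ∀ {r s} (b : Board r s) → T (boardSafe b) → Nonattacking b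
boardSafe⇒ []      _ ()
boardSafe⇒ (x ∷ b) t = nonattacking-∷ x b (rowSafe⇒ x (∧-fst (rowSafe x) t))
  (∧-fst (safeAbove x b) (∧-snd (rowSafe x) t)) (boardSafe⇒ b (∧-snd (safeAbove x b) (∧-snd (rowSafe x) t)))

boardSafe⇐ : ∀ {r s} (b : Board r s) → Nonattacking b → T (boardSafe b)
boardSafe⇐ []      _  = tt
boardSafe⇐ (x ∷ b) na = ∧-intro (rowSafe⇐ x (nonattacking-head na))
  (∧-intro (safeAbove⇐ b na) (boardSafe⇐ b (nonattacking-tail na)))
  where
  safeAbove⇐ : ∀ {r} (b : Board r _) → Nonattacking (x ∷ b) → T (safeAbove x b)
  safeAbove⇐ []      _  = tt
  safeAbove⇐ (y ∷ b) na = rowsSafe⇐ x y (nonattacking-adjacent na)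

nonattacking≡boardSafe : ∀ {r s} (b : Board r s) → nonattacking b ≡ boardSafe b
nonattacking≡boardSafe b = T-injective
  (boardSafe⇐ b ∘ proj₁ (nonattacking⇔ b)) (proj₂ (nonattacking⇔ b) ∘ boardSafe⇒ b)

kings : ∀ {s} → Row s → ℕ
kings []      = 0
kings (a ∷ x) = boolToℕ a + kings x

boardKings : ∀ {r s} → Board r s → ℕ
boardKings []      = 0
boardKings (x ∷ b) = kings x + boardKings b

kingCount≡boardKings : ∀ {r s} (b : Board r s) → kingCount b ≡ boardKings b
kingCount≡boardKings []      = refl
kingCount≡boardKings (x ∷ b) =
  trans (∑-allFin (λ i → ∑[ j ← allFin _ ] boolToℕ (occ (x ∷ b) i j))) (cong₂ _+_ (rowKings x) (kingCount≡boardKings b))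
  where
  rowKings : ∀ {s} (x : Row s) → ∑[ j ← allFin s ] boolToℕ (lookup x j) ≡ kings x
  rowKings []      = refl
  rowKings (a ∷ x) = trans (∑-allFin (boolToℕ ∘ lookup (a ∷ x))) (cong (boolToℕ a +_) (rowKings x))

-- Strips of 2×2 blocks

twice : ℕ → ℕ
twice zero    = zero
twice (suc n) = suc (suc (twice n))

twice≡2* : ∀ n → twice n ≡ 2 * n
twice≡2* zero    = refl
twice≡2* (suc n) = cong suc (trans (cong suc (twice≡2* n)) (sym (+-suc n (n + 0))))

stripSafe : ∀ {s} → Row s → Row s → Bool
stripSafe t u = rowSafe t ∧ rowSafe u ∧ rowsSafe t u

blockKings : Bool → Bool → Bool → Bool → ℕ
blockKings t₀ t₁ u₀ u₁ = boolToℕ t₀ + (boolToℕ t₁ + (boolToℕ u₀ + boolToℕ u₁))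

atMostOneKing : Bool → Bool → Bool → Bool → Bool
atMostOneKing t₀ t₁ u₀ u₁ = blockKings t₀ t₁ u₀ u₁ ≤ᵇ 1

exactlyOneKing : Bool → Bool → Bool → Bool → Bool
exactlyOneKing t₀ t₁ u₀ u₁ = blockKings t₀ t₁ u₀ u₁ ≡ᵇ 1

-- the right column of a 2×2 block against the left column of the next block
columnsSeparated : Bool → Bool → Bool → Bool → Bool
columnsSeparated t₁ u₁ x y = not ((t₁ ∨ u₁) ∧ (x ∨ y))

stripSafe-∷ : ∀ {s} (t₀ t₁ u₀ u₁ : Bool) (t u : Row s) →
  stripSafe (t₀ ∷ t₁ ∷ t) (u₀ ∷ u₁ ∷ u) ≡
  atMostOneKing t₀ t₁ u₀ u₁ ∧ columnsSeparated t₁ u₁ (firstCell t) (firstCell u) ∧ stripSafe t u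
stripSafe-∷ t₀ t₁ u₀ u₁ t u = bool-identity 9
  (λ where (t₀ ∷ t₁ ∷ u₀ ∷ u₁ ∷ x ∷ y ∷ r ∷ r′ ∷ p ∷ []) →
             (not (t₀ ∧ t₁) ∧ not (t₁ ∧ x) ∧ r) ∧ (not (u₀ ∧ u₁) ∧ not (u₁ ∧ y) ∧ r′) ∧
             not (t₀ ∧ u₀) ∧ not (t₀ ∧ u₁) ∧ not (u₀ ∧ t₁) ∧ not (t₁ ∧ u₁) ∧ not (t₁ ∧ y) ∧ not (u₁ ∧ x) ∧ p)
  (λ where (t₀ ∷ t₁ ∷ u₀ ∷ u₁ ∷ x ∷ y ∷ r ∷ r′ ∷ p ∷ []) →
             atMostOneKing t₀ t₁ u₀ u₁ ∧ columnsSeparated t₁ u₁ x y ∧ r ∧ r′ ∧ p)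
  tt (t₀ ∷ t₁ ∷ u₀ ∷ u₁ ∷ firstCell t ∷ firstCell u ∷ rowSafe t ∷ rowSafe u ∷ rowsSafe t u ∷ [])

kings-∷² : ∀ {s} (t₀ t₁ u₀ u₁ : Bool) (t u : Row s) →
  kings (t₀ ∷ t₁ ∷ t) + kings (u₀ ∷ u₁ ∷ u) ≡ blockKings t₀ t₁ u₀ u₁ + (kings t + kings u)
kings-∷² t₀ t₁ u₀ u₁ t u =
  solve 6 (λ a b c d x y → a :+ (b :+ x) :+ (c :+ (d :+ y)) := a :+ (b :+ (c :+ d)) :+ (x :+ y)) refl
    (boolToℕ t₀) (boolToℕ t₁) (boolToℕ u₀) (boolToℕ u₁) (kings t) (kings u)
  where open +-*-Solver

stripSafe⇒kings≤ : ∀ n (t u : Row (twice n)) → T (stripSafe t u) → kings t + kings u ≤ n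
stripSafe⇒kings≤ zero    []                []                _ = z≤n
stripSafe⇒kings≤ (suc n) (t₀ ∷ t₁ ∷ t) (u₀ ∷ u₁ ∷ u) safe =
  subst (_≤ suc n) (sym (kings-∷² t₀ t₁ u₀ u₁ t u))
    (+-mono-≤ (≤ᵇ⇒≤ (blockKings t₀ t₁ u₀ u₁) 1 (∧-fst (atMostOneKing t₀ t₁ u₀ u₁) safe′))
              (stripSafe⇒kings≤ n t u (∧-snd (columnsSeparated t₁ u₁ (firstCell t) (firstCell u)) (∧-snd (atMostOneKing t₀ t₁ u₀ u₁) safe′))))
  where safe′ = subst T (stripSafe-∷ t₀ t₁ u₀ u₁ t u) safe

+-≡-bounds : ∀ {a b m n} → a ≤ m → b ≤ n → a + b ≡ m + n → a ≡ m × b ≡ n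
+-≡-bounds {a} {b} {m} {n} a≤m b≤n eq =
  ≤-antisym a≤m (+-cancelʳ-≤ n m a (≤-trans (≤-reflexive (sym eq)) (+-monoʳ-≤ a b≤n))) ,
  ≤-antisym b≤n (+-cancelˡ-≤ m n b (≤-trans (≤-reflexive (sym eq)) (+-monoˡ-≤ b a≤m)))

saturated : ∀ n → Row (twice n) → Row (twice n) → Bool
saturated n t u = stripSafe t u ∧ (kings t + kings u ≡ᵇ n)

saturated-∷ : ∀ n (t₀ t₁ u₀ u₁ : Bool) (t u : Row (twice n)) →
  saturated (suc n) (t₀ ∷ t₁ ∷ t) (u₀ ∷ u₁ ∷ u) ≡
  exactlyOneKing t₀ t₁ u₀ u₁ ∧ columnsSeparated t₁ u₁ (firstCell t) (firstCell u) ∧ saturated n t u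
saturated-∷ n t₀ t₁ u₀ u₁ t u = T-injective ⇒ ⇐
  where
  B = blockKings t₀ t₁ u₀ u₁
  S = columnsSeparated t₁ u₁ (firstCell t) (firstCell u)
  ⇒ : T (saturated (suc n) (t₀ ∷ t₁ ∷ t) (u₀ ∷ u₁ ∷ u)) → T (exactlyOneKing t₀ t₁ u₀ u₁ ∧ S ∧ saturated n t u)
  ⇒ sat = ∧-intro (≡⇒≡ᵇ B 1 (proj₁ counts)) (∧-intro (∧-fst S rest) (∧-intro tailSafe (≡⇒≡ᵇ _ n (proj₂ counts))))
    where
    safe = subst T (stripSafe-∷ t₀ t₁ u₀ u₁ t u) (∧-fst (stripSafe (t₀ ∷ t₁ ∷ t) (u₀ ∷ u₁ ∷ u)) sat)
    rest = ∧-snd (atMostOneKing t₀ t₁ u₀ u₁) safe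
    tailSafe = ∧-snd S rest
    counts = +-≡-bounds (≤ᵇ⇒≤ B 1 (∧-fst (atMostOneKing t₀ t₁ u₀ u₁) safe)) (stripSafe⇒kings≤ n t u tailSafe)
      (trans (sym (kings-∷² t₀ t₁ u₀ u₁ t u))
             (≡ᵇ⇒≡ _ (suc n) (∧-snd (stripSafe (t₀ ∷ t₁ ∷ t) (u₀ ∷ u₁ ∷ u)) sat)))
  ⇐ : T (exactlyOneKing t₀ t₁ u₀ u₁ ∧ S ∧ saturated n t u) → T (saturated (suc n) (t₀ ∷ t₁ ∷ t) (u₀ ∷ u₁ ∷ u))
  ⇐ h = ∧-intro (subst T (sym (stripSafe-∷ t₀ t₁ u₀ u₁ t u)) (∧-intro (≤⇒≤ᵇ (≤-reflexive one)) (∧-intro sep (∧-fst (stripSafe t u) sat))))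
                (≡⇒≡ᵇ _ (suc n) (trans (kings-∷² t₀ t₁ u₀ u₁ t u) (cong₂ _+_ one (≡ᵇ⇒≡ _ n (∧-snd (stripSafe t u) sat)))))
    where
    one = ≡ᵇ⇒≡ B 1 (∧-fst (exactlyOneKing t₀ t₁ u₀ u₁) h)
    sep = ∧-fst S (∧-snd (exactlyOneKing t₀ t₁ u₀ u₁) h)
    sat = ∧-snd S (∧-snd (exactlyOneKing t₀ t₁ u₀ u₁) h)

saturatedBoard : ∀ n m → Board (twice m) (twice n) → Bool
saturatedBoard n zero    []          = true
saturatedBoard n (suc m) (t ∷ u ∷ b) = saturated n t u ∧ safeAbove u b ∧ saturatedBoard n m b

boardSafe-∷² : ∀ {r s} (t u : Row s) (b : Board r s) →
  boardSafe (t ∷ u ∷ b) ≡ stripSafe t u ∧ safeAbove u b ∧ boardSafe b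
boardSafe-∷² t u b = bool-identity 5
  (λ where (r ∷ r′ ∷ p ∷ a ∷ q ∷ []) → r ∧ p ∧ r′ ∧ a ∧ q)
  (λ where (r ∷ r′ ∷ p ∷ a ∷ q ∷ []) → (r ∧ r′ ∧ p) ∧ a ∧ q)
  tt (rowSafe t ∷ rowSafe u ∷ rowsSafe t u ∷ safeAbove u b ∷ boardSafe b ∷ [])

boardSafe⇒kings≤ : ∀ n m (b : Board (twice m) (twice n)) → T (boardSafe b) → boardKings b ≤ m * n
boardSafe⇒kings≤ n zero    []          _    = z≤n
boardSafe⇒kings≤ n (suc m) (t ∷ u ∷ b) safe =
  subst (_≤ n + m * n) (+-assoc (kings t) (kings u) (boardKings b))
    (+-mono-≤ (stripSafe⇒kings≤ n t u (∧-fst (stripSafe t u) safe′))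
              (boardSafe⇒kings≤ n m b (∧-snd (safeAbove u b) (∧-snd (stripSafe t u) safe′))))
  where safe′ = subst T (boardSafe-∷² t u b) safe

maximumBoard≡saturatedBoard : ∀ n m (b : Board (twice m) (twice n)) →
  boardSafe b ∧ (boardKings b ≡ᵇ m * n) ≡ saturatedBoard n m b
maximumBoard≡saturatedBoard n zero    []          = refl
maximumBoard≡saturatedBoard n (suc m) (t ∷ u ∷ b) = T-injective ⇒ ⇐
  where
  strip-kings : boardKings (t ∷ u ∷ b) ≡ (kings t + kings u) + boardKings b
  strip-kings = sym (+-assoc (kings t) (kings u) (boardKings b))
  ⇒ : T (boardSafe (t ∷ u ∷ b) ∧ (boardKings (t ∷ u ∷ b) ≡ᵇ suc m * n)) → T (saturatedBoard n (suc m) (t ∷ u ∷ b))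
  ⇒ h = ∧-intro (∧-intro stripOK (≡⇒≡ᵇ _ n (proj₁ counts)))
          (∧-intro aboveOK (subst T (maximumBoard≡saturatedBoard n m b) (∧-intro restOK (≡⇒≡ᵇ _ (m * n) (proj₂ counts)))))
    where
    safe = subst T (boardSafe-∷² t u b) (∧-fst (boardSafe (t ∷ u ∷ b)) h)
    stripOK = ∧-fst (stripSafe t u) safe
    aboveOK = ∧-fst (safeAbove u b) (∧-snd (stripSafe t u) safe)
    restOK = ∧-snd (safeAbove u b) (∧-snd (stripSafe t u) safe)
    counts = +-≡-bounds (stripSafe⇒kings≤ n t u stripOK) (boardSafe⇒kings≤ n m b restOK)
      (trans (sym strip-kings) (≡ᵇ⇒≡ _ _ (∧-snd (boardSafe (t ∷ u ∷ b)) h)))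
  ⇐ : T (saturatedBoard n (suc m) (t ∷ u ∷ b)) → T (boardSafe (t ∷ u ∷ b) ∧ (boardKings (t ∷ u ∷ b) ≡ᵇ suc m * n))
  ⇐ h = ∧-intro (subst T (sym (boardSafe-∷² t u b)) (∧-intro (∧-fst (stripSafe t u) sat) (∧-intro aboveOK (∧-fst (boardSafe b) rest))))
          (≡⇒≡ᵇ _ _ (trans strip-kings (cong₂ _+_ (≡ᵇ⇒≡ (kings t + kings u) n (∧-snd (stripSafe t u) sat)) (≡ᵇ⇒≡ (boardKings b) (m * n) (∧-snd (boardSafe b) rest)))))
    where
    sat = ∧-fst (saturated n t u) h
    aboveOK = ∧-fst (safeAbove u b) (∧-snd (saturated n t u) h)
    rest = subst T (sym (maximumBoard≡saturatedBoard n m b)) (∧-snd (safeAbove u b) (∧-snd (saturated n t u) h))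

isMaxArrangement≡saturatedBoard : ∀ n m (b : Board (twice m) (twice n)) →
  nonattacking b ∧ (kingCount b ≡ᵇ m * n) ≡ saturatedBoard n m b
isMaxArrangement≡saturatedBoard n m b
  rewrite nonattacking≡boardSafe b | kingCount≡boardKings b = maximumBoard≡saturatedBoard n m b

rows : ∀ n → List (Row (twice n))
rows n = allVecs (twice n) bools

saturatedSum : ∀ n → (Row (twice n) → Row (twice n) → ℕ) → ℕ
saturatedSum n F = ∑[ t ← rows n ] ∑[ u ← rows n ] (boolToℕ (saturated n t u) * F t u)

-- The saturated strip whose kings lie in the top row exactly in the blocks of A,
-- and in the left column exactly in the blocks 1, …, k - 1.
topRow : ∀ {n} → Sub n → ℕ → Row (twice n)
topRow []      k             = []
topRow (a ∷ A) (suc (suc k)) = a ∷ false ∷ topRow A (suc k)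
topRow (a ∷ A) k             = false ∷ a ∷ topRow A 1

bottomRow : ∀ {n} → Sub n → ℕ → Row (twice n)
bottomRow []      k             = []
bottomRow (a ∷ A) (suc (suc k)) = not a ∷ false ∷ bottomRow A (suc k)
bottomRow (a ∷ A) k             = false ∷ not a ∷ bottomRow A 1

∑-rows²-∷ : ∀ n (H : Row (twice (suc n)) → Row (twice (suc n)) → ℕ) →
  ∑[ t ← rows (suc n) ] ∑[ u ← rows (suc n) ] H t u ≡
  ∑[ t₀ ← bools ] ∑[ t₁ ← bools ] ∑[ u₀ ← bools ] ∑[ u₁ ← bools ]
    ∑[ t ← rows n ] ∑[ u ← rows n ] H (t₀ ∷ t₁ ∷ t) (u₀ ∷ u₁ ∷ u)
∑-rows²-∷ n H = begin
  ∑[ t ← rows (suc n) ] ∑[ u ← rows (suc n) ] H t u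
    ≡⟨ ∑-allVecs² (twice n) bools (λ t → ∑[ u ← rows (suc n) ] H t u) ⟩
  ∑[ t₀ ← bools ] ∑[ t₁ ← bools ] ∑[ t ← rows n ] ∑[ u ← rows (suc n) ] H (t₀ ∷ t₁ ∷ t) u
    ≡⟨ each² (λ t₀ t₁ → ∑-cong (rows n) λ t → ∑-allVecs² (twice n) bools (H (t₀ ∷ t₁ ∷ t))) ⟩
  ∑[ t₀ ← bools ] ∑[ t₁ ← bools ] ∑[ t ← rows n ] ∑[ u₀ ← bools ] ∑[ u₁ ← bools ] ∑[ u ← rows n ] H (t₀ ∷ t₁ ∷ t) (u₀ ∷ u₁ ∷ u)
    ≡⟨ each² (λ t₀ t₁ → ∑-comm (rows n) bools λ t u₀ → ∑[ u₁ ← bools ] ∑[ u ← rows n ] H (t₀ ∷ t₁ ∷ t) (u₀ ∷ u₁ ∷ u)) ⟩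
  ∑[ t₀ ← bools ] ∑[ t₁ ← bools ] ∑[ u₀ ← bools ] ∑[ t ← rows n ] ∑[ u₁ ← bools ] ∑[ u ← rows n ] H (t₀ ∷ t₁ ∷ t) (u₀ ∷ u₁ ∷ u)
    ≡⟨ each² (λ t₀ t₁ → ∑-cong bools λ u₀ → ∑-comm (rows n) bools λ t u₁ → ∑[ u ← rows n ] H (t₀ ∷ t₁ ∷ t) (u₀ ∷ u₁ ∷ u)) ⟩
  ∑[ t₀ ← bools ] ∑[ t₁ ← bools ] ∑[ u₀ ← bools ] ∑[ u₁ ← bools ] ∑[ t ← rows n ] ∑[ u ← rows n ] H (t₀ ∷ t₁ ∷ t) (u₀ ∷ u₁ ∷ u)
    ∎
  where
  open ≡-Reasoning
  each² : ∀ {f g : Bool → Bool → ℕ} → (∀ a b → f a b ≡ g a b) → ∑[ a ← bools ] ∑[ b ← bools ] f a b ≡ ∑[ a ← bools ] ∑[ b ← bools ] g a b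
  each² e = ∑-cong bools λ a → ∑-cong bools (e a)

∑-oneKingBlocks : (W : Bool → Bool → Bool → Bool → ℕ) →
  ∑[ t₀ ← bools ] ∑[ t₁ ← bools ] ∑[ u₀ ← bools ] ∑[ u₁ ← bools ] (boolToℕ (exactlyOneKing t₀ t₁ u₀ u₁) * W t₀ t₁ u₀ u₁)
  ≡ W true false false false + W false true false false + (W false false true false + W false false false true)
∑-oneKingBlocks W = normalise (W true false false false) (W false true false false) (W false false true false) (W false false false true)
  where
  -- the left-hand side with the sixteen indicators evaluated
  normalise : ∀ x y z w → ((((0 + (0 + 0)) + ((0 + (0 + 0)) + 0)) + (((0 + (0 + 0)) + ((0 + ((x + 0) + 0)) + 0)) + 0)) + ((((0 + (0 + 0)) + ((0 + ((y + 0) + 0)) + 0)) + (((0 + ((z + 0) + 0)) + (((w + 0) + (0 + 0)) + 0)) + 0)) + 0)) ≡ x + y + (z + w)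
  normalise = solve-∀

withBlock : ∀ {n} → (Row (twice (suc n)) → Row (twice (suc n)) → ℕ) →
  Bool → Bool → Bool → Bool → Row (twice n) → Row (twice n) → ℕ
withBlock F t₀ t₁ u₀ u₁ t u =
  boolToℕ (columnsSeparated t₁ u₁ (firstCell t) (firstCell u)) * F (t₀ ∷ t₁ ∷ t) (u₀ ∷ u₁ ∷ u)

saturatedSum-∷ : ∀ n (F : Row (twice (suc n)) → Row (twice (suc n)) → ℕ) →
  let W = λ t₀ t₁ u₀ u₁ → saturatedSum n (withBlock F t₀ t₁ u₀ u₁) in
  saturatedSum (suc n) F ≡ W true false false false + W false true false false + (W false false true false + W false false false true)
saturatedSum-∷ n F =
  trans (∑-rows²-∷ n (λ t u → boolToℕ (saturated (suc n) t u) * F t u))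
    (trans (∑-cong bools λ t₀ → ∑-cong bools λ t₁ → ∑-cong bools λ u₀ → ∑-cong bools λ u₁ → factorBlock t₀ t₁ u₀ u₁)
           (∑-oneKingBlocks (λ t₀ t₁ u₀ u₁ → saturatedSum n (withBlock F t₀ t₁ u₀ u₁))))
  where
  factorBlock : ∀ t₀ t₁ u₀ u₁ →
    ∑[ t ← rows n ] ∑[ u ← rows n ] (boolToℕ (saturated (suc n) (t₀ ∷ t₁ ∷ t) (u₀ ∷ u₁ ∷ u)) * F (t₀ ∷ t₁ ∷ t) (u₀ ∷ u₁ ∷ u))
    ≡ boolToℕ (exactlyOneKing t₀ t₁ u₀ u₁) * saturatedSum n (withBlock F t₀ t₁ u₀ u₁)
  factorBlock t₀ t₁ u₀ u₁ =
    trans (∑-cong (rows n) λ t → trans (∑-cong (rows n) λ u → term t u) (∑-*ˡ (rows n) E _))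
          (∑-*ˡ (rows n) E _)
    where
    E = boolToℕ (exactlyOneKing t₀ t₁ u₀ u₁)
    term : ∀ t u → boolToℕ (saturated (suc n) (t₀ ∷ t₁ ∷ t) (u₀ ∷ u₁ ∷ u)) * F (t₀ ∷ t₁ ∷ t) (u₀ ∷ u₁ ∷ u)
                   ≡ E * (boolToℕ (saturated n t u) * withBlock F t₀ t₁ u₀ u₁ t u)
    term t u = begin
      boolToℕ (saturated (suc n) (t₀ ∷ t₁ ∷ t) (u₀ ∷ u₁ ∷ u)) * V
        ≡⟨ cong (λ b → boolToℕ b * V) (saturated-∷ n t₀ t₁ u₀ u₁ t u) ⟩
      boolToℕ (exactlyOneKing t₀ t₁ u₀ u₁ ∧ S ∧ saturated n t u) * V
        ≡⟨ cong (_* V) (trans (boolToℕ-∧ (exactlyOneKing t₀ t₁ u₀ u₁) _) (cong (E *_) (boolToℕ-∧ S (saturated n t u)))) ⟩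
      E * (boolToℕ S * boolToℕ (saturated n t u)) * V
        ≡⟨ solve 4 (λ e s a v → e :* (s :* a) :* v := e :* (a :* (s :* v))) refl E (boolToℕ S) (boolToℕ (saturated n t u)) V ⟩
      E * (boolToℕ (saturated n t u) * (boolToℕ S * V)) ∎
      where
      open ≡-Reasoning
      open +-*-Solver
      V = F (t₀ ∷ t₁ ∷ t) (u₀ ∷ u₁ ∷ u)
      S = columnsSeparated t₁ u₁ (firstCell t) (firstCell u)

strips : ∀ n → (Row (twice n) → Row (twice n) → ℕ) → ℕ
strips n F = ∑[ A ← allSubs n ] ∑[ j < suc n ] F (topRow A (suc j)) (bottomRow A (suc j))

-- Blocks to the right of a king in a right column have their kings in the right column too.
∑-rightColumn : ∀ n (A : Sub n) (c : Bool) → T c → (G : ℕ → ℕ) →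
  ∑[ j < suc n ] (boolToℕ (not (c ∧ (firstCell (topRow A (suc j)) ∨ firstCell (bottomRow A (suc j))))) * G j) ≡ G 0
∑-rightColumn zero    []          true _ G = trans (+-identityʳ _) (+-identityʳ _)
∑-rightColumn (suc n) (true ∷ A)  true _ G = trans (cong₂ _+_ (+-identityʳ (G 0)) (∑<-zero (suc n))) (+-identityʳ _)
∑-rightColumn (suc n) (false ∷ A) true _ G = trans (cong₂ _+_ (+-identityʳ (G 0)) (∑<-zero (suc n))) (+-identityʳ _)

saturatedSum≡strips : ∀ n (F : Row (twice n) → Row (twice n) → ℕ) → saturatedSum n F ≡ strips n F
saturatedSum≡strips zero    F = cong (_+ 0) (+-identityʳ (F [] [] + 0))
saturatedSum≡strips (suc n) F = begin
  saturatedSum (suc n) F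
    ≡⟨ saturatedSum-∷ n F ⟩
  W true false false false + W false true false false + (W false false true false + W false false false true)
    ≡⟨ cong₂ _+_ (cong₂ _+_ (left true) (right true)) (cong₂ _+_ (left false) (right false)) ⟩
  ∑ (allSubs n) (L true) + ∑ (allSubs n) (R true) + (∑ (allSubs n) (L false) + ∑ (allSubs n) (R false))
    ≡⟨ solve 4 (λ a b c d → a :+ b :+ (c :+ d) := b :+ a :+ ((d :+ c) :+ con 0)) refl
         (∑ (allSubs n) (L true)) (∑ (allSubs n) (R true)) (∑ (allSubs n) (L false)) (∑ (allSubs n) (R false)) ⟩
  ∑ (allSubs n) (R true) + ∑ (allSubs n) (L true) + ((∑ (allSubs n) (R false) + ∑ (allSubs n) (L false)) + 0)
    ≡⟨ sym (cong₂ _+_ (∑-+ (allSubs n) (R true) (L true)) (cong (_+ 0) (∑-+ (allSubs n) (R false) (L false)))) ⟩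
  ∑[ a ← bools ] ∑[ A ← allSubs n ] (R a A + L a A)
    ≡⟨ sym (∑-allVecs n bools (λ A → ∑[ j < suc (suc n) ] F (topRow A (suc j)) (bottomRow A (suc j)))) ⟩
  strips (suc n) F ∎
  where
  open ≡-Reasoning
  open +-*-Solver
  W = λ t₀ t₁ u₀ u₁ → saturatedSum n (withBlock F t₀ t₁ u₀ u₁)
  L R : Bool → Sub n → ℕ
  L a A = ∑[ j < suc n ] F (a ∷ false ∷ topRow A (suc j)) (not a ∷ false ∷ bottomRow A (suc j))
  R a A = F (false ∷ a ∷ topRow A 1) (false ∷ not a ∷ bottomRow A 1)
  left : ∀ a → W a false (not a) false ≡ ∑ (allSubs n) (L a)
  left a = trans (saturatedSum≡strips n (withBlock F a false (not a) false))
    (∑-cong (allSubs n) λ A → ∑<-cong (suc n) {g = λ j → F (a ∷ false ∷ topRow A (suc j)) (not a ∷ false ∷ bottomRow A (suc j))} λ j _ → +-identityʳ _)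
  right : ∀ a → W false a false (not a) ≡ ∑ (allSubs n) (R a)
  right a = trans (saturatedSum≡strips n (withBlock F false a false (not a)))
    (∑-cong (allSubs n) λ A → ∑-rightColumn n A (a ∨ not a) (subst T (sym (∨-inverseʳ a)) tt)
                                (λ j → F (false ∷ a ∷ topRow A (suc j)) (false ∷ not a ∷ bottomRow A (suc j))))

-- Compatibility of consecutive strips

-- pred₁ k = max (k - 1) 1: the switching column once the first block is removed
pred₁ : ℕ → ℕ
pred₁ (suc (suc k)) = suc k
pred₁ _             = 1

topRow-∷ : ∀ {n} (a : Bool) (A : Sub n) k →
  topRow (a ∷ A) k ≡ (not (k <ᵇ 2) ∧ a) ∷ ((k <ᵇ 2) ∧ a) ∷ topRow A (pred₁ k)
topRow-∷ a A zero          = refl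
topRow-∷ a A (suc zero)    = refl
topRow-∷ a A (suc (suc k)) = refl

bottomRow-∷ : ∀ {n} (a : Bool) (A : Sub n) k →
  bottomRow (a ∷ A) k ≡ (not (k <ᵇ 2) ∧ not a) ∷ ((k <ᵇ 2) ∧ not a) ∷ bottomRow A (pred₁ k)
bottomRow-∷ a A zero          = refl
bottomRow-∷ a A (suc zero)    = refl
bottomRow-∷ a A (suc (suc k)) = refl

rowsSafe-∷ : ∀ {n} (a b : Bool) (A B : Sub n) k i →
  rowsSafe (bottomRow (a ∷ A) k) (topRow (b ∷ B) i) ≡
  (not b ∨ a) ∧ not (((k <ᵇ 2) ∧ not a) ∧ firstCell (topRow B (pred₁ i)))
              ∧ not (((i <ᵇ 2) ∧ b) ∧ firstCell (bottomRow A (pred₁ k)))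
              ∧ rowsSafe (bottomRow A (pred₁ k)) (topRow B (pred₁ i))
rowsSafe-∷ a b A B k i rewrite bottomRow-∷ a A k | topRow-∷ b B i = bool-identity 7
  (λ where (a ∷ b ∷ c ∷ d ∷ x ∷ y ∷ p ∷ []) →
             not ((not c ∧ not a) ∧ (not d ∧ b)) ∧ not ((not c ∧ not a) ∧ (d ∧ b)) ∧ not ((not d ∧ b) ∧ (c ∧ not a)) ∧
             not ((c ∧ not a) ∧ (d ∧ b)) ∧ not ((c ∧ not a) ∧ y) ∧ not ((d ∧ b) ∧ x) ∧ p)
  (λ where (a ∷ b ∷ c ∷ d ∷ x ∷ y ∷ p ∷ []) → (not b ∨ a) ∧ not ((c ∧ not a) ∧ y) ∧ not ((d ∧ b) ∧ x) ∧ p)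
  tt (a ∷ b ∷ (k <ᵇ 2) ∷ (i <ᵇ 2) ∷ firstCell (bottomRow A (pred₁ k)) ∷ firstCell (topRow B (pred₁ i))
        ∷ rowsSafe (bottomRow A (pred₁ k)) (topRow B (pred₁ i)) ∷ [])

infix 4 _⊆ᵇ_
_⊆ᵇ_ : ∀ {n} → Sub n → Sub n → Bool
[]      ⊆ᵇ []      = true
(b ∷ B) ⊆ᵇ (a ∷ A) = (not b ∨ a) ∧ (B ⊆ᵇ A)

-- the j whose maximum (resp. minimum) defines p(A,B,k) (resp. q(A,B,k))
pWitness : ∀ {n} → Sub n → Sub n → ℕ → ℕ → Bool
pWitness A B k j = (j <ᵇ k) ∧ not (j ∈ₛ A) ∧ ((j ∸ 1) ∈ₛ B)

qWitness : ∀ {n} → Sub n → Sub n → ℕ → ℕ → Bool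
qWitness A B k j = (k <ᵇ j) ∧ (j ∈ₛ B) ∧ not ((j ∸ 1) ∈ₛ A)

Between : ∀ {n} → Sub n → Sub n → ℕ → ℕ → Set
Between A B k i = (∀ j → T (pWitness A B k j) → j ≤ i) × (∀ j → T (qWitness A B k j) → i ≤ j)

∉[] : ∀ j → T (j ∈ₛ ([] {A = Bool})) → ⊥
∉[] zero    ()
∉[] (suc j) ()

∈ₛ⇒≤ : ∀ {n} (B : Sub n) j → T (j ∈ₛ B) → j ≤ n
∈ₛ⇒≤ (b ∷ B) (suc zero)    _ = s≤s z≤n
∈ₛ⇒≤ (b ∷ B) (suc (suc j)) t = s≤s (∈ₛ⇒≤ B (suc j) t)

pWitness⇒∈ : ∀ {n} (A B : Sub n) k j → T (pWitness A B k j) → T ((j ∸ 1) ∈ₛ B)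
pWitness⇒∈ A B k j t = ∧-snd (not (j ∈ₛ A)) (∧-snd (j <ᵇ k) t)

qWitness⇒∈ : ∀ {n} (A B : Sub n) k j → T (qWitness A B k j) → T (j ∈ₛ B)
qWitness⇒∈ A B k j t = ∧-fst (j ∈ₛ B) (∧-snd (k <ᵇ j) t)

qWitness⇒< : ∀ {n} (A B : Sub n) k j → T (qWitness A B k j) → T (k <ᵇ j)
qWitness⇒< A B k j = ∧-fst (k <ᵇ j)

pWitness-∷ : ∀ {n} a b (A B : Sub n) k j → 1 ≤ k →
  pWitness (a ∷ A) (b ∷ B) k (3 + j) ≡ pWitness A B (pred₁ k) (2 + j)
pWitness-∷ a b A B (suc zero)    j _ = refl
pWitness-∷ a b A B (suc (suc k)) j _ = refl

qWitness-∷ : ∀ {n} a b (A B : Sub n) k j → 1 ≤ k →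
  qWitness (a ∷ A) (b ∷ B) k (3 + j) ≡ qWitness A B (pred₁ k) (2 + j)
qWitness-∷ a b A B (suc zero)    j _ = refl
qWitness-∷ a b A B (suc (suc k)) j _ = refl

pred₁-monoʳ : ∀ i j → 1 ≤ i → (3 + j ≤ i → 2 + j ≤ pred₁ i) × (2 + j ≤ pred₁ i → 3 + j ≤ i)
pred₁-monoʳ (suc zero)    j _ = (λ { (s≤s ()) }) , (λ { (s≤s ()) })
pred₁-monoʳ (suc (suc i)) j _ = (λ { (s≤s le) → le }) , s≤s

pred₁-monoˡ : ∀ i j → 1 ≤ i → (i ≤ 3 + j → pred₁ i ≤ 2 + j) × (pred₁ i ≤ 2 + j → i ≤ 3 + j)
pred₁-monoˡ (suc zero)    j _ = (λ _ → s≤s z≤n) , (λ _ → s≤s z≤n)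
pred₁-monoˡ (suc (suc i)) j _ = (λ { (s≤s le) → le }) , s≤s

1≤pred₁ : ∀ k → 1 ≤ pred₁ k
1≤pred₁ zero          = s≤s z≤n
1≤pred₁ (suc zero)    = s≤s z≤n
1≤pred₁ (suc (suc k)) = s≤s z≤n

pred₁-≤ : ∀ k n → k ≤ suc (suc n) → pred₁ k ≤ suc n
pred₁-≤ zero          n _               = s≤s z≤n
pred₁-≤ (suc zero)    n _               = s≤s z≤n
pred₁-≤ (suc (suc k)) n (s≤s (s≤s k≤n)) = s≤s k≤n

module _ {n} (a b : Bool) (A B : Sub n) (k i : ℕ) (1≤k : 1 ≤ k) (1≤i : 1 ≤ i) where

  Between-∷⁻ : Between (a ∷ A) (b ∷ B) k i →
    (T (pWitness (a ∷ A) (b ∷ B) k 2) → 2 ≤ i) × (T (qWitness (a ∷ A) (b ∷ B) k 2) → i ≤ 2) ×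
    Between A B (pred₁ k) (pred₁ i)
  Between-∷⁻ (P , Q) = P 2 , Q 2 , P′ , Q′
    where
    P′ : ∀ j → T (pWitness A B (pred₁ k) j) → j ≤ pred₁ i
    P′ zero          w = ⊥-elim (pWitness⇒∈ A B (pred₁ k) 0 w)
    P′ (suc zero)    w = ⊥-elim (pWitness⇒∈ A B (pred₁ k) 1 w)
    P′ (suc (suc j)) w = proj₁ (pred₁-monoʳ i j 1≤i) (P (3 + j) (subst T (sym (pWitness-∷ a b A B k j 1≤k)) w))
    Q′ : ∀ j → T (qWitness A B (pred₁ k) j) → pred₁ i ≤ j
    Q′ zero          w = ⊥-elim (qWitness⇒∈ A B (pred₁ k) 0 w)
    Q′ (suc zero)    w = ⊥-elim (<⇒≱ (<ᵇ⇒< (pred₁ k) 1 (qWitness⇒< A B (pred₁ k) 1 w)) (1≤pred₁ k))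
    Q′ (suc (suc j)) w = proj₁ (pred₁-monoˡ i j 1≤i) (Q (3 + j) (subst T (sym (qWitness-∷ a b A B k j 1≤k)) w))

  Between-∷⁺ : (T (pWitness (a ∷ A) (b ∷ B) k 2) → 2 ≤ i) → (T (qWitness (a ∷ A) (b ∷ B) k 2) → i ≤ 2) →
    Between A B (pred₁ k) (pred₁ i) → Between (a ∷ A) (b ∷ B) k i
  Between-∷⁺ p₂ q₂ (P′ , Q′) = P , Q
    where
    P : ∀ j → T (pWitness (a ∷ A) (b ∷ B) k j) → j ≤ i
    P zero                w = ⊥-elim (pWitness⇒∈ (a ∷ A) (b ∷ B) k 0 w)
    P (suc zero)          w = ⊥-elim (pWitness⇒∈ (a ∷ A) (b ∷ B) k 1 w)
    P (suc (suc zero))    w = p₂ w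
    P (suc (suc (suc j))) w = proj₂ (pred₁-monoʳ i j 1≤i) (P′ (2 + j) (subst T (pWitness-∷ a b A B k j 1≤k) w))
    Q : ∀ j → T (qWitness (a ∷ A) (b ∷ B) k j) → i ≤ j
    Q zero                w = ⊥-elim (qWitness⇒∈ (a ∷ A) (b ∷ B) k 0 w)
    Q (suc zero)          w = ⊥-elim (<⇒≱ (<ᵇ⇒< k 1 (qWitness⇒< (a ∷ A) (b ∷ B) k 1 w)) 1≤k)
    Q (suc (suc zero))    w = q₂ w
    Q (suc (suc (suc j))) w = proj₂ (pred₁-monoˡ i j 1≤i) (Q′ (2 + j) (subst T (qWitness-∷ a b A B k j 1≤k) w))

firstCell-topRow : ∀ {n} (B : Sub n) i → firstCell (topRow B (pred₁ i)) ≡ (2 <ᵇ i) ∧ (1 ∈ₛ B)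
firstCell-topRow []      zero                = refl
firstCell-topRow []      (suc zero)          = refl
firstCell-topRow []      (suc (suc zero))    = refl
firstCell-topRow []      (suc (suc (suc i))) = refl
firstCell-topRow (b ∷ B) zero                = refl
firstCell-topRow (b ∷ B) (suc zero)          = refl
firstCell-topRow (b ∷ B) (suc (suc zero))    = refl
firstCell-topRow (b ∷ B) (suc (suc (suc i))) = refl

firstCell-bottomRow : ∀ {n} (A : Sub n) k → k ≤ suc (suc n) → firstCell (bottomRow A (pred₁ k)) ≡ (2 <ᵇ k) ∧ not (1 ∈ₛ A)
firstCell-bottomRow []      zero                _ = refl
firstCell-bottomRow []      (suc zero)          _ = refl
firstCell-bottomRow []      (suc (suc zero))    _ = refl
firstCell-bottomRow []      (suc (suc (suc k))) (s≤s (s≤s ()))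
firstCell-bottomRow (a ∷ A) zero                _ = refl
firstCell-bottomRow (a ∷ A) (suc zero)          _ = refl
firstCell-bottomRow (a ∷ A) (suc (suc zero))    _ = refl
firstCell-bottomRow (a ∷ A) (suc (suc (suc k))) _ = refl

rowsSafe-strips-∷ : ∀ {n} (a b : Bool) (A B : Sub n) k i → k ≤ suc (suc n) →
  rowsSafe (bottomRow (a ∷ A) k) (topRow (b ∷ B) i) ≡
  (not b ∨ a) ∧ not (pWitness (a ∷ A) (b ∷ B) k 2 ∧ (i <ᵇ 2)) ∧ not (qWitness (a ∷ A) (b ∷ B) k 2 ∧ (2 <ᵇ i))
              ∧ rowsSafe (bottomRow A (pred₁ k)) (topRow B (pred₁ i))
rowsSafe-strips-∷ a b A B k i k≤
  rewrite rowsSafe-∷ a b A B k i | firstCell-topRow B i | firstCell-bottomRow A k k≤ = bool-identity 9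
  (λ where (a ∷ b ∷ c ∷ d ∷ e ∷ f ∷ m ∷ h ∷ p ∷ []) →
             (not b ∨ a) ∧ not ((c ∧ not a) ∧ (e ∧ m)) ∧ not ((d ∧ b) ∧ (f ∧ not h)) ∧ p)
  (λ where (a ∷ b ∷ c ∷ d ∷ e ∷ f ∷ m ∷ h ∷ p ∷ []) →
             (not b ∨ a) ∧ not ((f ∧ not h ∧ b) ∧ d) ∧ not ((c ∧ m ∧ not a) ∧ e) ∧ p)
  tt (a ∷ b ∷ (k <ᵇ 2) ∷ (i <ᵇ 2) ∷ (2 <ᵇ i) ∷ (2 <ᵇ k) ∷ (1 ∈ₛ B) ∷ (1 ∈ₛ A)
        ∷ rowsSafe (bottomRow A (pred₁ k)) (topRow B (pred₁ i)) ∷ [])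

not-∧-<ᵇ : ∀ w m n → (T (not (w ∧ (m <ᵇ n))) → T w → n ≤ m) × ((T w → n ≤ m) → T (not (w ∧ (m <ᵇ n))))
not-∧-<ᵇ w m n =
  (λ t tw → ≮⇒≥ λ m<n → not-elim t (∧-intro tw (<⇒<ᵇ m<n))) ,
  (λ f → not-intro λ t → <⇒≱ (<ᵇ⇒< m n (∧-snd w t)) (f (∧-fst w t)))

Compatible : ∀ {n} → Sub n → Sub n → ℕ → ℕ → Set
Compatible A B k i = T (B ⊆ᵇ A) × Between A B k i

rowsSafe⇔Compatible : ∀ n (A B : Sub n) k i → 1 ≤ k → k ≤ suc n → 1 ≤ i →
  (T (rowsSafe (bottomRow A k) (topRow B i)) → Compatible A B k i) ×
  (Compatible A B k i → T (rowsSafe (bottomRow A k) (topRow B i)))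
rowsSafe⇔Compatible zero [] [] k i _ _ _ =
  (λ _ → tt , (λ j w → ⊥-elim (∉[] (j ∸ 1) (pWitness⇒∈ [] [] k j w))) , (λ j w → ⊥-elim (∉[] j (qWitness⇒∈ [] [] k j w)))) ,
  (λ _ → tt)
rowsSafe⇔Compatible (suc n) (a ∷ A) (b ∷ B) k i 1≤k k≤ 1≤i
  rewrite rowsSafe-strips-∷ a b A B k i k≤ = ⇒ , ⇐
  where
  pW = pWitness (a ∷ A) (b ∷ B) k 2
  qW = qWitness (a ∷ A) (b ∷ B) k 2
  IH = rowsSafe⇔Compatible n A B (pred₁ k) (pred₁ i) (1≤pred₁ k) (pred₁-≤ k n k≤) (1≤pred₁ i)
  ⇒ : T ((not b ∨ a) ∧ not (pW ∧ (i <ᵇ 2)) ∧ not (qW ∧ (2 <ᵇ i)) ∧ rowsSafe (bottomRow A (pred₁ k)) (topRow B (pred₁ i))) →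
      Compatible (a ∷ A) (b ∷ B) k i
  ⇒ t = ∧-intro (∧-fst (not b ∨ a) t) (proj₁ rest) ,
        Between-∷⁺ a b A B k i 1≤k 1≤i (proj₁ (not-∧-<ᵇ pW i 2) pBound) (proj₁ (not-∧-<ᵇ qW 2 i) qBound) (proj₂ rest)
    where
    t₁ = ∧-snd (not b ∨ a) t
    pBound = ∧-fst (not (pW ∧ (i <ᵇ 2))) t₁
    t₂ = ∧-snd (not (pW ∧ (i <ᵇ 2))) t₁
    qBound = ∧-fst (not (qW ∧ (2 <ᵇ i))) t₂
    rest = proj₁ IH (∧-snd (not (qW ∧ (2 <ᵇ i))) t₂)
  ⇐ : Compatible (a ∷ A) (b ∷ B) k i →
      T ((not b ∨ a) ∧ not (pW ∧ (i <ᵇ 2)) ∧ not (qW ∧ (2 <ᵇ i)) ∧ rowsSafe (bottomRow A (pred₁ k)) (topRow B (pred₁ i)))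
  ⇐ (sub , between) with Between-∷⁻ a b A B k i 1≤k 1≤i between
  ... | pBound , qBound , between′ =
    ∧-intro (∧-fst (not b ∨ a) sub)
      (∧-intro (proj₂ (not-∧-<ᵇ pW i 2) pBound)
        (∧-intro (proj₂ (not-∧-<ᵇ qW 2 i) qBound)
          (proj₂ IH (∧-snd (not b ∨ a) sub , between′))))

foldr-⊔-if≤ : ∀ (c : ℕ → Bool) xs i → 1 ≤ i →
  (foldr _⊔_ 1 (map (λ j → if c j then j else 1) xs) ≤ i → ∀ {j} → j ∈ xs → T (c j) → j ≤ i) ×
  ((∀ {j} → j ∈ xs → T (c j) → j ≤ i) → foldr _⊔_ 1 (map (λ j → if c j then j else 1) xs) ≤ i)
foldr-⊔-if≤ c []       i 1≤i = (λ _ ()) , (λ _ → 1≤i)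
foldr-⊔-if≤ c (x ∷ xs) i 1≤i = ⇒ , ⇐
  where
  IH = foldr-⊔-if≤ c xs i 1≤i
  rest = foldr _⊔_ 1 (map (λ j → if c j then j else 1) xs)
  ⇒ : (if c x then x else 1) ⊔ rest ≤ i → ∀ {j} → j ∈ x ∷ xs → T (c j) → j ≤ i
  ⇒ le (here refl) t with c x
  ... | true = ≤-trans (m≤m⊔n x rest) le
  ⇒ le (there j∈) t = proj₁ IH (≤-trans (m≤n⊔m _ rest) le) j∈ t
  ⇐ : (∀ {j} → j ∈ x ∷ xs → T (c j) → j ≤ i) → (if c x then x else 1) ⊔ rest ≤ i
  ⇐ f = ⊔-lub (head (c x) (f (here refl))) (proj₂ IH (f ∘ there))
    where
    head : ∀ b → (T b → x ≤ i) → (if b then x else 1) ≤ i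
    head true  g = g tt
    head false _ = 1≤i

foldr-⊓-if≥ : ∀ (c : ℕ → Bool) d xs i → i ≤ d →
  (i ≤ foldr _⊓_ d (map (λ j → if c j then j else d) xs) → ∀ {j} → j ∈ xs → T (c j) → i ≤ j) ×
  ((∀ {j} → j ∈ xs → T (c j) → i ≤ j) → i ≤ foldr _⊓_ d (map (λ j → if c j then j else d) xs))
foldr-⊓-if≥ c d []       i i≤d = (λ _ ()) , (λ _ → i≤d)
foldr-⊓-if≥ c d (x ∷ xs) i i≤d = ⇒ , ⇐
  where
  IH = foldr-⊓-if≥ c d xs i i≤d
  rest = foldr _⊓_ d (map (λ j → if c j then j else d) xs)
  ⇒ : i ≤ (if c x then x else d) ⊓ rest → ∀ {j} → j ∈ x ∷ xs → T (c j) → i ≤ j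
  ⇒ le (here refl) t with c x
  ... | true = ≤-trans le (m⊓n≤m x rest)
  ⇒ le (there j∈) t = proj₁ IH (≤-trans le (m⊓n≤n _ rest)) j∈ t
  ⇐ : (∀ {j} → j ∈ x ∷ xs → T (c j) → i ≤ j) → i ≤ (if c x then x else d) ⊓ rest
  ⇐ f = ⊓-glb (head (c x) (f (here refl))) (proj₂ IH (f ∘ there))
    where
    head : ∀ b → (T b → i ≤ x) → i ≤ (if b then x else d)
    head true  g = g tt
    head false _ = i≤d

∈-range1 : ∀ n j → 1 ≤ j → j ≤ suc n → j ∈ range1 n
∈-range1 n (suc j) _ (s≤s j≤n) = ∈-map⁺ (1 +_) (∈-upTo⁺ (s≤s j≤n))

1≤pp : ∀ n (A B : Sub n) k → 1 ≤ pp n A B k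
1≤pp n A B k = go (map _ (range1 n))
  where
  go : ∀ xs → 1 ≤ foldr _⊔_ 1 xs
  go []       = s≤s z≤n
  go (x ∷ xs) = ≤-trans (go xs) (m≤n⊔m x _)

qq≤ : ∀ n (A B : Sub n) k → qq n A B k ≤ suc n
qq≤ n A B k = go (map _ (range1 n))
  where
  go : ∀ xs → foldr _⊓_ (suc n) xs ≤ suc n
  go []       = ≤-refl
  go (x ∷ xs) = ≤-trans (m⊓n≤n x _) (go xs)

pp≤⇔ : ∀ n (A B : Sub n) k i → 1 ≤ i →
  (pp n A B k ≤ i → ∀ j → T (pWitness A B k j) → j ≤ i) × ((∀ j → T (pWitness A B k j) → j ≤ i) → pp n A B k ≤ i)
pp≤⇔ n A B k i 1≤i =
  (λ le j w → proj₁ bound le (inRange j w) w) , (λ f → proj₂ bound λ {j} _ → f j)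
  where
  bound = foldr-⊔-if≤ (pWitness A B k) (range1 n) i 1≤i
  inRange : ∀ j → T (pWitness A B k j) → j ∈ range1 n
  inRange zero    w = ⊥-elim (pWitness⇒∈ A B k 0 w)
  inRange (suc j) w = ∈-range1 n (suc j) (s≤s z≤n) (s≤s (∈ₛ⇒≤ B j (pWitness⇒∈ A B k (suc j) w)))

≤qq⇔ : ∀ n (A B : Sub n) k i → i ≤ suc n →
  (i ≤ qq n A B k → ∀ j → T (qWitness A B k j) → i ≤ j) × ((∀ j → T (qWitness A B k j) → i ≤ j) → i ≤ qq n A B k)
≤qq⇔ n A B k i i≤ =
  (λ le j w → proj₁ bound le (inRange j w) w) , (λ f → proj₂ bound λ {j} _ → f j)
  where
  bound = foldr-⊓-if≥ (qWitness A B k) (suc n) (range1 n) i i≤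
  inRange : ∀ j → T (qWitness A B k j) → j ∈ range1 n
  inRange zero    w = ⊥-elim (qWitness⇒∈ A B k 0 w)
  inRange (suc j) w = ∈-range1 n (suc j) (s≤s z≤n) (m≤n⇒m≤1+n (∈ₛ⇒≤ B (suc j) (qWitness⇒∈ A B k (suc j) w)))

stripsCompatible≡ : ∀ n (A B : Sub n) k i → 1 ≤ k → k ≤ suc n → 1 ≤ i → i ≤ suc n →
  rowsSafe (bottomRow A k) (topRow B i) ≡ (B ⊆ᵇ A) ∧ ((pp n A B k ≤ᵇ i) ∧ (i ≤ᵇ qq n A B k))
stripsCompatible≡ n A B k i 1≤k k≤ 1≤i i≤ = T-injective ⇒ ⇐
  where
  compat = rowsSafe⇔Compatible n A B k i 1≤k k≤ 1≤i
  ⇒ : T (rowsSafe (bottomRow A k) (topRow B i)) → T ((B ⊆ᵇ A) ∧ ((pp n A B k ≤ᵇ i) ∧ (i ≤ᵇ qq n A B k)))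
  ⇒ t with proj₁ compat t
  ... | sub , P , Q = ∧-intro sub (∧-intro (≤⇒≤ᵇ (proj₂ (pp≤⇔ n A B k i 1≤i) P)) (≤⇒≤ᵇ (proj₂ (≤qq⇔ n A B k i i≤) Q)))
  ⇐ : T ((B ⊆ᵇ A) ∧ ((pp n A B k ≤ᵇ i) ∧ (i ≤ᵇ qq n A B k))) → T (rowsSafe (bottomRow A k) (topRow B i))
  ⇐ t = proj₂ compat (∧-fst (B ⊆ᵇ A) t ,
    proj₁ (pp≤⇔ n A B k i 1≤i) (≤ᵇ⇒≤ _ i (∧-fst (pp n A B k ≤ᵇ i) bounds)) ,
    proj₁ (≤qq⇔ n A B k i i≤) (≤ᵇ⇒≤ i _ (∧-snd (pp n A B k ≤ᵇ i) bounds)))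
    where bounds = ∧-snd (B ⊆ᵇ A) t

∑-⊆ᵇ : ∀ {n} (A : Sub n) (H : Sub n → ℕ) → ∑[ B ← allSubs n ] (boolToℕ (B ⊆ᵇ A) * H B) ≡ ∑ (subsOf A) H
∑-⊆ᵇ []          H = cong (_+ 0) (+-identityʳ (H []))
∑-⊆ᵇ {suc n} (true ∷ A)  H = begin
  ∑[ B ← allSubs (suc n) ] (boolToℕ (B ⊆ᵇ true ∷ A) * H B)
    ≡⟨ ∑-allVecs n bools (λ B → boolToℕ (B ⊆ᵇ true ∷ A) * H B) ⟩
  ∑[ B ← allSubs n ] (boolToℕ (B ⊆ᵇ A) * H (true ∷ B)) + (∑[ B ← allSubs n ] (boolToℕ (B ⊆ᵇ A) * H (false ∷ B)) + 0)
    ≡⟨ cong₂ _+_ (∑-⊆ᵇ A (H ∘ (true ∷_))) (trans (+-identityʳ _) (∑-⊆ᵇ A (H ∘ (false ∷_)))) ⟩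
  ∑ (subsOf A) (H ∘ (true ∷_)) + ∑ (subsOf A) (H ∘ (false ∷_))
    ≡⟨ +-comm (∑ (subsOf A) (H ∘ (true ∷_))) _ ⟩
  ∑ (subsOf A) (H ∘ (false ∷_)) + ∑ (subsOf A) (H ∘ (true ∷_))
    ≡⟨ sym (cong₂ _+_ (∑-map (subsOf A) (false ∷_) H) (∑-map (subsOf A) (true ∷_) H)) ⟩
  ∑ (map (false ∷_) (subsOf A)) H + ∑ (map (true ∷_) (subsOf A)) H
    ≡⟨ sym (∑-++ (map (false ∷_) (subsOf A)) _ H) ⟩
  ∑ (subsOf (true ∷ A)) H ∎
  where open ≡-Reasoning
∑-⊆ᵇ {suc n} (false ∷ A) H = begin
  ∑[ B ← allSubs (suc n) ] (boolToℕ (B ⊆ᵇ false ∷ A) * H B)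
    ≡⟨ ∑-allVecs n bools (λ B → boolToℕ (B ⊆ᵇ false ∷ A) * H B) ⟩
  ∑[ B ← allSubs n ] 0 + (∑[ B ← allSubs n ] (boolToℕ (B ⊆ᵇ A) * H (false ∷ B)) + 0)
    ≡⟨ cong₂ _+_ (∑-zero (allSubs n)) (trans (+-identityʳ _) (∑-⊆ᵇ A (H ∘ (false ∷_)))) ⟩
  ∑ (subsOf A) (H ∘ (false ∷_))
    ≡⟨ sym (∑-map (subsOf A) (false ∷_) H) ⟩
  ∑ (subsOf (false ∷ A)) H ∎
  where open ≡-Reasoning

-- Counting arrangements strip by strip

boards : ∀ n m → List (Board (twice m) (twice n))
boards n m = allVecs (twice m) (rows n)

completions : ∀ n m → Row (twice n) → ℕ
completions n m u = ∑[ b ← boards n m ] boolToℕ (safeAbove u b ∧ saturatedBoard n m b)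

∑-saturatedBoard-∷ : ∀ n m (g : Row (twice n) → Bool) →
  ∑[ t ← rows n ] ∑[ u ← rows n ] ∑[ b ← boards n m ] boolToℕ (g t ∧ saturatedBoard n (suc m) (t ∷ u ∷ b))
  ≡ saturatedSum n (λ t u → boolToℕ (g t) * completions n m u)
∑-saturatedBoard-∷ n m g = ∑-cong (rows n) λ t → ∑-cong (rows n) λ u →
  trans (∑-cong (boards n m) λ b → factor (g t) (saturated n t u) (safeAbove u b ∧ saturatedBoard n m b))
        (trans (∑-*ˡ (boards n m) (boolToℕ (saturated n t u)) _)
               (cong (boolToℕ (saturated n t u) *_) (∑-*ˡ (boards n m) (boolToℕ (g t)) _)))
  where
  open +-*-Solver
  factor : ∀ x y z → boolToℕ (x ∧ y ∧ z) ≡ boolToℕ y * (boolToℕ x * boolToℕ z)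
  factor x y z = begin
    boolToℕ (x ∧ y ∧ z)                   ≡⟨ trans (boolToℕ-∧ x _) (cong (boolToℕ x *_) (boolToℕ-∧ y z)) ⟩
    boolToℕ x * (boolToℕ y * boolToℕ z)   ≡⟨ solve 3 (λ x y z → x :* (y :* z) := y :* (x :* z)) refl (boolToℕ x) (boolToℕ y) (boolToℕ z) ⟩
    boolToℕ y * (boolToℕ x * boolToℕ z)   ∎
    where open ≡-Reasoning

completions≡c : ∀ n m (A : Sub n) k → 1 ≤ k → k ≤ suc n → completions n m (bottomRow A k) ≡ c n (suc m) A k
completions≡c n zero    A k _   _  = refl
completions≡c n (suc m) A k 1≤k k≤ = begin
  completions n (suc m) (bottomRow A k)
    ≡⟨ ∑-allVecs² (twice m) (rows n) _ ⟩
  ∑[ t ← rows n ] ∑[ u ← rows n ] ∑[ b ← boards n m ] boolToℕ (rowsSafe (bottomRow A k) t ∧ saturatedBoard n (suc m) (t ∷ u ∷ b))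
    ≡⟨ ∑-saturatedBoard-∷ n m (rowsSafe (bottomRow A k)) ⟩
  saturatedSum n (λ t u → boolToℕ (rowsSafe (bottomRow A k) t) * completions n m u)
    ≡⟨ saturatedSum≡strips n _ ⟩
  ∑[ B ← allSubs n ] ∑[ j < suc n ] (boolToℕ (rowsSafe (bottomRow A k) (topRow B (suc j))) * completions n m (bottomRow B (suc j)))
    ≡⟨ ∑-cong (allSubs n) (λ B → ∑<-cong (suc n) λ j j< →
         cong₂ _*_ (cong boolToℕ (stripsCompatible≡ n A B k (suc j) 1≤k k≤ (s≤s z≤n) j<))
                   (completions≡c n m B (suc j) (s≤s z≤n) j<)) ⟩
  ∑[ B ← allSubs n ] ∑[ j < suc n ] (boolToℕ ((B ⊆ᵇ A) ∧ window B j) * c n (suc m) B (suc j))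
    ≡⟨ ∑-cong (allSubs n) (λ B → trans (∑<-cong (suc n) λ j _ → split B j) (∑<-*ˡ (suc n) (boolToℕ (B ⊆ᵇ A)) λ j → boolToℕ (window B j) * c n (suc m) B (suc j))) ⟩
  ∑[ B ← allSubs n ] (boolToℕ (B ⊆ᵇ A) * ∑[ j < suc n ] (boolToℕ (window B j) * c n (suc m) B (suc j)))
    ≡⟨ ∑-⊆ᵇ A _ ⟩
  ∑[ B ← subsOf A ] ∑[ j < suc n ] (boolToℕ (window B j) * c n (suc m) B (suc j))
    ≡⟨ ∑-cong (subsOf A) (λ B → ∑<-indicator-fromTo n (pp n A B k) (qq n A B k) (c n (suc m) B) (1≤pp n A B k) (qq≤ n A B k)) ⟩
  c n (suc (suc m)) A k ∎
  where
  open ≡-Reasoning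
  window : Sub n → ℕ → Bool
  window B j = (pp n A B k ≤ᵇ suc j) ∧ (suc j ≤ᵇ qq n A B k)
  split : ∀ B j → boolToℕ ((B ⊆ᵇ A) ∧ window B j) * c n (suc m) B (suc j)
                ≡ boolToℕ (B ⊆ᵇ A) * (boolToℕ (window B j) * c n (suc m) B (suc j))
  split B j = trans (cong (_* c n (suc m) B (suc j)) (boolToℕ-∧ (B ⊆ᵇ A) (window B j)))
                    (*-assoc (boolToℕ (B ⊆ᵇ A)) _ _)

maxArrangements : ∀ n m → ℕ
maxArrangements n m = ∑[ b ← boards n m ] boolToℕ (saturatedBoard n m b)

K≡maxArrangements : ∀ n m → K n m ≡ maxArrangements n m
K≡maxArrangements n m = begin
  K n m
    ≡⟨ cong₂ (λ r s → length (filterᵇ (λ b → nonattacking b ∧ (kingCount b ≡ᵇ m * n)) (allVecs r (allVecs s bools))))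
             (sym (twice≡2* m)) (sym (twice≡2* n)) ⟩
  length (filterᵇ (λ b → nonattacking b ∧ (kingCount b ≡ᵇ m * n)) (boards n m))
    ≡⟨ length-filterᵇ _ (boards n m) ⟩
  ∑[ b ← boards n m ] boolToℕ (nonattacking b ∧ (kingCount b ≡ᵇ m * n))
    ≡⟨ ∑-cong (boards n m) (cong boolToℕ ∘ isMaxArrangement≡saturatedBoard n m) ⟩
  maxArrangements n m ∎
  where open ≡-Reasoning

maxArrangements≡∑c : ∀ n m → maxArrangements n (suc m) ≡ ∑[ A ← allSubs n ] ∑[ k ← fromTo 1 (suc n) ] c n (suc m) A k
maxArrangements≡∑c n m = begin
  maxArrangements n (suc m)
    ≡⟨ ∑-allVecs² (twice m) (rows n) _ ⟩
  ∑[ t ← rows n ] ∑[ u ← rows n ] ∑[ b ← boards n m ] boolToℕ (saturatedBoard n (suc m) (t ∷ u ∷ b))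
    ≡⟨ ∑-saturatedBoard-∷ n m (λ _ → true) ⟩
  saturatedSum n (λ _ u → 1 * completions n m u)
    ≡⟨ saturatedSum≡strips n _ ⟩
  ∑[ A ← allSubs n ] ∑[ j < suc n ] (1 * completions n m (bottomRow A (suc j)))
    ≡⟨ ∑-cong (allSubs n) (λ A → ∑<-cong (suc n) λ j j< → trans (*-identityˡ _) (completions≡c n m A (suc j) (s≤s z≤n) j<)) ⟩
  ∑[ A ← allSubs n ] ∑[ j < suc n ] c n (suc m) A (suc j)
    ≡⟨ ∑-cong (allSubs n) (λ A → sym (∑-fromTo 1 (suc n) (c n (suc m) A))) ⟩
  ∑[ A ← allSubs n ] ∑[ k ← fromTo 1 (suc n) ] c n (suc m) A k ∎
  where open ≡-Reasoning

corollary1 : (m n : ℕ) → 1 ≤ m → m ≤ n →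
    K n m ≡ sum (map (λ A → sum (map (λ k → c n m A k) (fromTo 1 (suc n)))) (allSubs n))
corollary1 (suc m) n _ _ = trans (K≡maxArrangements n (suc m)) (maxArrangements≡∑c n m)
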